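{- Let $(G,\sigma)$ be a flow-admissible signed graph. Suppose $V(G)=W_1\cup W_2$ is a partition into nonempty sets such that the set of edges between $W_1$ and $W_2$ is exactly $\{uv,xy\}$ with $u,x\in W_1$, $v,y\in W_2$, where $uv$ is positive and every edge of $G[W_2]$ is positive. Let $(G_1,\sigma_{G_1})$ be the signed graph obtained from $G[W_1]$ (with signs inherited from $\sigma$) by adding a new edge $ux$ with sign $\sigma(xy)$, and let $(G_2,\sigma_{G_2})$ be the all-positive signed graph obtained from $G[W_2]$ by adding a new positive edge $vy$. Then $(G_1,\sigma_{G_1})$ and $(G_2,\sigma_{G_2})$ are both flow-admissible.
   Context: Graphs are finite and may have parallel edges (and the added edges may create parallel edges or loops). A signed graph $(G,\sigma)$ is a graph $G$ with a map $\sigma:E(G)\to\{ -1,1\}$; edges with sign $-1$ are negative, others positive. Each edge $e=vw$ consists of two half-edges $h_v(e)$, $h_w(e)$. An orientation $D$ directs each half-edge towards or away from its end vertex so that for a positive edge exactly one half-edge is directed towards its end vertex, and for a negative edge both half-edges are directed away or both towards their end vertices. A $\mathbb{Z}$-flow $(D,\phi)$: $\phi:E(G)\to\mathbb{Z}$ such that at every vertex $v$ the sum of $\phi(e)$ over half-edges at $v$ directed towards $v$ equals the sum over half-edges directed away from $v$. A nowhere-zero $k$-flow is a $\mathbb{Z}$-flow with $0<|\phi(e)|<k$ for all $e$. $(G,\sigma)$ is flow-admissible if it admits a nowhere-zero $k$-flow for some $k$. -}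

module Defs where

open import Data.Nat using (ℕ; _<_)
open import Data.Integer as ℤ using (ℤ; ∣_∣; -_; _+_; 0ℤ)
open import Data.Bool as Bool using (Bool; true; false; not; if_then_else_; _∧_)
open import Data.Fin using (Fin; zero; suc)
open import Data.List as List using (List; []; _∷_; mapMaybe; length; lookup; tabulate)
open import Data.Maybe using (Maybe; just; nothing)
open import Data.Product using (Σ; ∃; _×_; _,_; proj₁; proj₂)
open import Data.Product.Properties using (≡-dec)
open import Relation.Binary.PropositionalEquality using (_≡_; refl)
open import Relation.Binary.Definitions using (DecidableEquality)
open import Relation.Nullary using (yes; no)
open import Relation.Nullary.Decidable using (⌊_⌋)
open import Axiom.UniquenessOfIdentityProofs using (module Decidable⇒UIP)

-- Signed graphs (parallel edges and loops allowed).
-- Vertex type V; edges are Fin m; edge e has ends (ends e) = (a , b),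
-- i.e. half-edge 1 at a and half-edge 2 at b.

data Sign : Set where
  pos neg : Sign

record SignedGraph (V : Set) : Set where
  constructor mkSG
  field
    m    : ℕ
    ends : Fin m → V × V
    sign : Fin m → Sign
open SignedGraph public

fromList : {V : Set} → List (V × V × Sign) → SignedGraph V
fromList l = mkSG (length l)
                  (λ i → proj₁ (lookup l i) , proj₁ (proj₂ (lookup l i)))
                  (λ i → proj₂ (proj₂ (lookup l i)))

edgeList : {V : Set} → SignedGraph V → List (V × V × Sign)
edgeList G = tabulate (λ e → proj₁ (ends G e) , proj₂ (ends G e) , sign G e)

-- Orientations and flows.
-- An orientation gives, for each edge, a pair of Booleans
-- (d₁ , d₂): dᵢ = true iff half-edge i is directed towards its end vertex.

ValidDir : Sign → Bool × Bool → Set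
ValidDir pos (d₁ , d₂) = d₁ ≡ not d₂
ValidDir neg (d₁ , d₂) = d₁ ≡ d₂

IsOrientation : {V : Set} → (G : SignedGraph V) → (Fin (m G) → Bool × Bool) → Set
IsOrientation G D = ∀ e → ValidDir (sign G e) (D e)

sumℤ : ∀ {k} → (Fin k → ℤ) → ℤ
sumℤ {ℕ.zero}  f = 0ℤ
sumℤ {ℕ.suc k} f = f zero + sumℤ (λ i → f (suc i))

module _ {V : Set} (_≟_ : DecidableEquality V) (G : SignedGraph V)
         (D : Fin (m G) → Bool × Bool) (φ : Fin (m G) → ℤ) where

  half : V → V → Bool → Bool → ℤ → ℤ
  half v w d dir x = if ⌊ w ≟ v ⌋ ∧ (if dir then d else not d) then x else 0ℤ

  inflow : V → ℤ
  inflow v = sumℤ (λ e → half v (proj₁ (ends G e)) (proj₁ (D e)) true (φ e)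
                       + half v (proj₂ (ends G e)) (proj₂ (D e)) true (φ e))

  outflow : V → ℤ
  outflow v = sumℤ (λ e → half v (proj₁ (ends G e)) (proj₁ (D e)) false (φ e)
                        + half v (proj₂ (ends G e)) (proj₂ (D e)) false (φ e))

  IsZFlow : Set
  IsZFlow = IsOrientation G D × (∀ v → inflow v ≡ outflow v)

  IsNowhereZeroFlow : ℕ → Set
  IsNowhereZeroFlow k = IsZFlow × (∀ e → 0 < ∣ φ e ∣ × ∣ φ e ∣ < k)

FlowAdmissible : {V : Set} → DecidableEquality V → SignedGraph V → Set
FlowAdmissible _≟_ G =
  ∃ λ (k : ℕ) → ∃ λ (D : Fin (m G) → Bool × Bool) → ∃ λ (φ : Fin (m G) → ℤ) →
    IsNowhereZeroFlow _≟_ G D φ k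

-- Vertex partitions of Fin n given by side : Fin n → Bool
-- (W₁ = side⁻¹ false, W₂ = side⁻¹ true) and induced subgraphs.

Part : ∀ {n} → (Fin n → Bool) → Bool → Set
Part {n} side b = Σ (Fin n) (λ v → side v ≡ b)

Part-≟ : ∀ {n} (side : Fin n → Bool) (b : Bool) → DecidableEquality (Part side b)
Part-≟ side b = ≡-dec Data.Fin._≟_ (λ p q → yes (Decidable⇒UIP.≡-irrelevant Bool._≟_ p q))
  where import Data.Fin

liftV : ∀ {n} (side : Fin n → Bool) (b : Bool) → Fin n → Maybe (Part side b)
liftV side b v with side v Bool.≟ b
... | yes p = just (v , p)
... | no _  = nothing

liftE : ∀ {n} (side : Fin n → Bool) (b : Bool) →
        Fin n × Fin n × Sign → Maybe (Part side b × Part side b × Sign)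
liftE side b (x , y , s) with liftV side b x | liftV side b y
... | just x' | just y' = just (x' , y' , s)
... | _       | _       = nothing

inducedEdges : ∀ {n} → SignedGraph (Fin n) → (side : Fin n → Bool) (b : Bool) →
               List (Part side b × Part side b × Sign)
inducedEdges G side b = mapMaybe (liftE side b) (edgeList G)

inducedPlus : ∀ {n} → SignedGraph (Fin n) → (side : Fin n → Bool) (b : Bool) →
              Part side b → Part side b → Sign → SignedGraph (Part side b)
inducedPlus G side b a c s = fromList ((a , c , s) ∷ inducedEdges G side b)

Joins : ∀ {V : Set} (G : SignedGraph V) → Fin (m G) → V → V → Set
Joins G e a c = ends G e ≡ (a , c) ⊎' ends G e ≡ (c , a)
  where open import Data.Sum renaming (_⊎_ to _⊎'_)

module Submission where

-- Let (D, φ) be a nowhere-zero k-flow on G and let the cut between W₁ and W₂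
-- consist of the edges e₁ = uv and e₂ = xy.  Write z_w for the signed value
-- of a cut edge at its end w (+φ if the half-edge points towards w, −φ if
-- away); a valid orientation gives z_c = −z_a across a positive edge ac and
-- z_c = z_a across a negative one ("transmission").
--
-- (1) Cut balance: summing the conservation law over all vertices of W₂ and
--     exchanging the two sums, every positive edge inside W₂ contributes
--     z_a + z_c = 0 and edges outside W₂ contribute nothing, so z_v + z_y = 0.
-- (2) Restriction: let a₁, a₂ ∈ W be the ends of e₁, e₂ in a side W.  If
--     transmission of sign s carries the value of e₁ at a₁ to the value of
--     e₂ at a₂, then a new edge a₁a₂ of sign s carrying φ(e₁) can be oriented
--     to show exactly these values, so at every vertex of W it replaces the
--     two cut edges and G[W] + a₁a₂ inherits a nowhere-zero k-flow.
-- The theorem follows by applying (2) to both sides; the side conditions on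
-- the signed values are derived from (1) and the transmission rule.

open import Defs
open import Data.Nat using (ℕ; zero; suc; _<_)
open import Data.Integer using (ℤ; 0ℤ; _+_; -_; ∣_∣)
import Data.Integer.Properties as ℤP
open import Data.Bool as Bool using (Bool; true; false; not; if_then_else_)
open import Data.Fin using (Fin; zero; suc; _≟_; punchIn)
open import Data.Fin.Properties using (punchInᵢ≢i)
open import Data.List using (mapMaybe; length; lookup; tabulate)
open import Data.Maybe using (Maybe; just; nothing; maybe′)
open import Data.Product using (∃; _×_; _,_; proj₁; proj₂)
open import Data.Sum using (_⊎_; inj₁; inj₂)
open import Data.Bool.Properties using (not-involutive; not-¬)
open import Data.Empty using (⊥-elim)
open import Function using (_∘_)
open import Function.Bundles using (mk⇔)
open import Relation.Binary.PropositionalEquality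
open import Relation.Binary.Definitions using (DecidableEquality)
open import Relation.Nullary using (Dec; yes; no; ¬_)
open import Relation.Nullary.Decidable using (⌊_⌋; isYes≗does; does-⇔)
open import Axiom.UniquenessOfIdentityProofs using (module Decidable⇒UIP)
open import Algebra.Properties.CommutativeMonoid.Sum ℤP.+-0-commutativeMonoid
  using (sum; sum-cong-≗; sum-replicate-zero; sum-remove; ∑-distrib-+; ∑-comm)
open import Algebra.Properties.CommutativeSemigroup ℤP.+-commutativeSemigroup
  using (interchange)
open import Algebra.Properties.AbelianGroup ℤP.+-0-abelianGroup
  using (∙-cancelˡ; inverseʳ-unique)

open ≡-Reasoning

-- The sum used in Defs is the library's sum, so the library's lemmas apply.
sumℤ≡sum : ∀ {k} (f : Fin k → ℤ) → sumℤ f ≡ sum f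
sumℤ≡sum {zero}  f = refl
sumℤ≡sum {suc k} f = cong (f zero +_) (sumℤ≡sum (f ∘ suc))

sum-zero : ∀ {k} {f : Fin k → ℤ} → (∀ i → f i ≡ 0ℤ) → sum f ≡ 0ℤ
sum-zero {k} f≗0 = trans (sum-cong-≗ f≗0) (sum-replicate-zero k)

module PointMass {V : Set} (_≟V_ : DecidableEquality V) where

  δ : V → V → ℤ → ℤ
  δ a w z = if ⌊ a ≟V w ⌋ then z else 0ℤ

  δ-self : ∀ a z → δ a a z ≡ z
  δ-self a z with a ≟V a
  ... | yes _  = refl
  ... | no a≢a = ⊥-elim (a≢a refl)

  δ-off : ∀ {a w} z → a ≢ w → δ a w z ≡ 0ℤ
  δ-off {a} {w} z a≢w with a ≟V w
  ... | yes a≡w = ⊥-elim (a≢w a≡w)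
  ... | no _    = refl

open PointMass using (δ; δ-self; δ-off)

sum-δ : ∀ {k} (a : Fin k) z → sum (λ w → δ _≟_ a w z) ≡ z
sum-δ {suc k} a z = begin
  sum (λ w → δ _≟_ a w z)                            ≡⟨ sum-remove {i = a} (λ w → δ _≟_ a w z) ⟩
  δ _≟_ a a z + sum (λ j → δ _≟_ a (punchIn a j) z)  ≡⟨ cong₂ _+_ (δ-self _≟_ a z) away ⟩
  z + 0ℤ                                             ≡⟨ ℤP.+-identityʳ z ⟩
  z                                                  ∎
  where
  away : sum (λ j → δ _≟_ a (punchIn a j) z) ≡ 0ℤ
  away = sum-zero (λ j → δ-off _≟_ z (punchInᵢ≢i a j ∘ sym))

signed : Bool → ℤ → ℤ
signed true  z = z
signed false z = - z

-- How a valid orientation relates the signed values at the two ends of an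
-- edge: they cancel across a positive edge and agree across a negative one.
transmit : Sign → ℤ → ℤ
transmit pos z = - z
transmit neg z = z

transmit-involutive : ∀ s z → transmit s (transmit s z) ≡ z
transmit-involutive pos z = ℤP.neg-involutive z
transmit-involutive neg z = refl

valid⇒transmit : ∀ s d₁ d₂ z → ValidDir s (d₁ , d₂) →
                 signed d₂ z ≡ transmit s (signed d₁ z)
valid⇒transmit pos .false true  z refl = sym (ℤP.neg-involutive z)
valid⇒transmit pos .true  false z refl = refl
valid⇒transmit neg d₁     .d₁   z refl = refl

farDir : Sign → Bool → Bool
farDir pos d = not d
farDir neg d = d

farDir-valid : ∀ s d → ValidDir s (d , farDir s d)
farDir-valid pos d = sym (not-involutive d)
farDir-valid neg d = refl

reverse : ∀ {V} {G : SignedGraph V} {e a c} → Joins G e a c → Joins G e c a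
reverse (inj₁ ends≡ac) = inj₂ ends≡ac
reverse (inj₂ ends≡ca) = inj₁ ends≡ca

SameSide Crossing : ∀ {V} (G : SignedGraph V) → (V → Bool) → Fin (m G) → Set
SameSide G side e = side (proj₁ (ends G e)) ≡ side (proj₂ (ends G e))
Crossing G side e = ¬ SameSide G side e

joins-crossing : ∀ {V} (G : SignedGraph V) (side : V → Bool) {e a c b} →
  Joins G e a c → side a ≡ b → side c ≡ not b → Crossing G side e
joins-crossing G side (inj₁ ends≡ac) a∈b c∉b rewrite ends≡ac | a∈b | c∉b = not-¬ refl
joins-crossing G side (inj₂ ends≡ca) a∈b c∉b rewrite ends≡ca | a∈b | c∉b = not-¬ refl ∘ sym

module Net {V : Set} (_≟V_ : DecidableEquality V) (G : SignedGraph V)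
           (D : Fin (m G) → Bool × Bool) (φ : Fin (m G) → ℤ) where

  value₁ value₂ : Fin (m G) → ℤ
  value₁ e = signed (proj₁ (D e)) (φ e)
  value₂ e = signed (proj₂ (D e)) (φ e)

  at : V × V → Fin (m G) → V → ℤ
  at (x , y) e v = δ _≟V_ x v (value₁ e) + δ _≟V_ y v (value₂ e)

  contribution : V → Fin (m G) → ℤ
  contribution v e = at (ends G e) e v

  net : V → ℤ
  net v = sum (contribution v)

  flowIn flowOut : V → ℤ
  flowIn  = inflow _≟V_ G D φ
  flowOut = outflow _≟V_ G D φ

  half-split : ∀ v w d x →
    half _≟V_ G D φ v w d true x ≡ half _≟V_ G D φ v w d false x + δ _≟V_ w v (signed d x)
  half-split v w d x with ⌊ w ≟V v ⌋
  half-split v w true  x | true  = sym (ℤP.+-identityˡ x)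
  half-split v w false x | true  = sym (ℤP.+-inverseʳ x)
  half-split v w d     x | false = refl

  flowIn≡flowOut+net : ∀ v → flowIn v ≡ flowOut v + net v
  flowIn≡flowOut+net v = begin
    flowIn v
      ≡⟨ sumℤ≡sum (λ e → h₁ true e + h₂ true e) ⟩
    sum (λ e → h₁ true e + h₂ true e)
      ≡⟨ sum-cong-≗ per-edge ⟩
    sum (λ e → (h₁ false e + h₂ false e) + contribution v e)
      ≡⟨ ∑-distrib-+ _ (contribution v) ⟩
    sum (λ e → h₁ false e + h₂ false e) + net v
      ≡⟨ cong (_+ net v) (sumℤ≡sum (λ e → h₁ false e + h₂ false e)) ⟨
    flowOut v + net v
      ∎
    where
    h₁ h₂ : Bool → Fin (m G) → ℤ
    h₁ dir e = half _≟V_ G D φ v (proj₁ (ends G e)) (proj₁ (D e)) dir (φ e)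
    h₂ dir e = half _≟V_ G D φ v (proj₂ (ends G e)) (proj₂ (D e)) dir (φ e)
    per-edge : ∀ e → h₁ true e + h₂ true e ≡ (h₁ false e + h₂ false e) + contribution v e
    per-edge e = trans
      (cong₂ _+_ (half-split v _ (proj₁ (D e)) (φ e)) (half-split v _ (proj₂ (D e)) (φ e)))
      (interchange (h₁ false e) _ (h₂ false e) _)

  conserved⇒net≡0 : ∀ v → flowIn v ≡ flowOut v → net v ≡ 0ℤ
  conserved⇒net≡0 v conserved = ∙-cancelˡ (flowOut v) _ _ (begin
    flowOut v + net v  ≡⟨ flowIn≡flowOut+net v ⟨
    flowIn v           ≡⟨ conserved ⟩
    flowOut v          ≡⟨ ℤP.+-identityʳ _ ⟨
    flowOut v + 0ℤ     ∎)

  net≡0⇒conserved : ∀ v → net v ≡ 0ℤ → flowIn v ≡ flowOut v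
  net≡0⇒conserved v balanced = begin
    flowIn v           ≡⟨ flowIn≡flowOut+net v ⟩
    flowOut v + net v  ≡⟨ cong (flowOut v +_) balanced ⟩
    flowOut v + 0ℤ     ≡⟨ ℤP.+-identityʳ _ ⟩
    flowOut v          ∎

  dirAt : ∀ {e a c} → Joins G e a c → Bool
  dirAt {e} (inj₁ _) = proj₁ (D e)
  dirAt {e} (inj₂ _) = proj₂ (D e)

  valueAt : ∀ {e a c} → Joins G e a c → ℤ
  valueAt {e} J = signed (dirAt J) (φ e)

  contribution-joins : ∀ {e a c} (J : Joins G e a c) v →
    contribution v e ≡ δ _≟V_ a v (valueAt J) + δ _≟V_ c v (valueAt (reverse {G = G} J))
  contribution-joins {e} (inj₁ ends≡ac) v = cong (λ ends → at ends e v) ends≡ac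
  contribution-joins {e} {a} {c} (inj₂ ends≡ca) v =
    trans (cong (λ ends → at ends e v) ends≡ca) (ℤP.+-comm (δ _≟V_ c v (value₁ e)) _)

  joins-transmit : ∀ {e a c} (J : Joins G e a c) → ValidDir (sign G e) (D e) →
    valueAt (reverse {G = G} J) ≡ transmit (sign G e) (valueAt J)
  joins-transmit {e} (inj₁ _) valid = valid⇒transmit (sign G e) _ _ (φ e) valid
  joins-transmit {e} (inj₂ _) valid = begin
    value₁ e                  ≡⟨ transmit-involutive σ (value₁ e) ⟨
    transmit σ (transmit σ (value₁ e))
                              ≡⟨ cong (transmit σ) (valid⇒transmit σ _ _ (φ e) valid) ⟨
    transmit σ (value₂ e)     ∎
    where
    σ : Sign
    σ = sign G e

module TwoEdgeCut {V : Set} (G : SignedGraph V) (side : V → Bool)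
                  (e₁ e₂ : Fin (m G)) (e₁≢e₂ : e₁ ≢ e₂)
                  (cut : ∀ e → Crossing G side e → e ≡ e₁ ⊎ e ≡ e₂)
                  (e₁-crosses : Crossing G side e₁) (e₂-crosses : Crossing G side e₂) where

  not-cut : ∀ {e e′} → Crossing G side e → SameSide G side e′ → e ≢ e′
  not-cut crosses same refl = crosses same

  sum-along-cut : (F H : Fin (m G) → ℤ) →
    (∀ e → SameSide G side e → F e ≡ H e) →
    (∀ e → Crossing G side e → H e ≡ 0ℤ) →
    sum F ≡ sum H + F e₁ + F e₂
  sum-along-cut F H off-cut on-cut = begin
    sum F
      ≡⟨ sum-cong-≗ per-edge ⟩
    sum (λ e → H e + mass₁ e + mass₂ e)
      ≡⟨ ∑-distrib-+ (λ e → H e + mass₁ e) mass₂ ⟩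
    sum (λ e → H e + mass₁ e) + sum mass₂
      ≡⟨ cong₂ _+_ (∑-distrib-+ H mass₁) (sum-δ e₂ (F e₂)) ⟩
    sum H + sum mass₁ + F e₂
      ≡⟨ cong (λ t → sum H + t + F e₂) (sum-δ e₁ (F e₁)) ⟩
    sum H + F e₁ + F e₂
      ∎
    where
    mass₁ mass₂ : Fin (m G) → ℤ
    mass₁ e = δ _≟_ e₁ e (F e₁)
    mass₂ e = δ _≟_ e₂ e (F e₂)

    per-edge : ∀ e → F e ≡ H e + mass₁ e + mass₂ e
    per-edge e with side (proj₁ (ends G e)) Bool.≟ side (proj₂ (ends G e))
    ... | yes same
      rewrite δ-off _≟_ (F e₁) (not-cut e₁-crosses same)
            | δ-off _≟_ (F e₂) (not-cut e₂-crosses same)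
      = trans (off-cut e same) (sym (trans (ℤP.+-identityʳ _) (ℤP.+-identityʳ (H e))))
    ... | no crosses with cut e crosses
    ...   | inj₁ refl
      rewrite on-cut e₁ crosses | δ-self _≟_ e₁ (F e₁) | δ-off _≟_ (F e₂) (e₁≢e₂ ∘ sym)
      = sym (trans (ℤP.+-identityʳ _) (ℤP.+-identityˡ (F e)))
    ...   | inj₂ refl
      rewrite on-cut e₂ crosses | δ-self _≟_ e₂ (F e₂) | δ-off _≟_ (F e₁) e₁≢e₂
      = sym (ℤP.+-identityˡ (F e))

module Balance {n : ℕ} (G : SignedGraph (Fin n)) (D : Fin (m G) → Bool × Bool)
               (φ : Fin (m G) → ℤ) (flow : IsZFlow _≟_ G D φ) (side : Fin n → Bool)
               (positive : ∀ e → side (proj₁ (ends G e)) ≡ true →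
                                 side (proj₂ (ends G e)) ≡ true → sign G e ≡ pos) where

  open Net _≟_ G D φ

  onSide : Fin n → ℤ → ℤ
  onSide w z = if side w then z else 0ℤ

  onSide-+ : ∀ w x y → onSide w (x + y) ≡ onSide w x + onSide w y
  onSide-+ w x y with side w
  ... | true  = refl
  ... | false = refl

  onSide-δ : ∀ a w z → onSide w (δ _≟_ a w z) ≡ δ _≟_ a w (onSide a z)
  onSide-δ a w z with a ≟ w
  ... | yes refl = refl
  ... | no _ with side w
  ...   | true  = refl
  ...   | false = refl

  sideTotal : Fin (m G) → ℤ
  sideTotal e = sum (λ w → onSide w (contribution w e))

  sideTotal-joins : ∀ {e a c} (J : Joins G e a c) →
    sideTotal e ≡ onSide a (valueAt J) + onSide c (valueAt (reverse {G = G} J))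
  sideTotal-joins {e} {a} {c} J = begin
    sideTotal e
      ≡⟨ sum-cong-≗ (λ w → trans (cong (onSide w) (contribution-joins J w)) (onSide-+ w _ _)) ⟩
    sum (λ w → onSide w (δ _≟_ a w z) + onSide w (δ _≟_ c w z′))
      ≡⟨ ∑-distrib-+ (λ w → onSide w (δ _≟_ a w z)) _ ⟩
    sum (λ w → onSide w (δ _≟_ a w z)) + sum (λ w → onSide w (δ _≟_ c w z′))
      ≡⟨ cong₂ _+_ (mass a z) (mass c z′) ⟩
    onSide a z + onSide c z′
      ∎
    where
    z z′ : ℤ
    z  = valueAt J
    z′ = valueAt (reverse {G = G} J)
    mass : ∀ b x → sum (λ w → onSide w (δ _≟_ b w x)) ≡ onSide b x
    mass b x = trans (sum-cong-≗ (λ w → onSide-δ b w x)) (sum-δ b (onSide b x))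

  -- An edge inside S is positive, so its two signed values cancel; an edge
  -- outside S is invisible from S.
  sideTotal-off-cut : ∀ e → SameSide G side e → sideTotal e ≡ 0ℤ
  sideTotal-off-cut e same =
    trans (sideTotal-joins {e} (inj₁ refl)) (ends-cancel _ refl (sym same))
    where
    ends-cancel : ∀ t → side (proj₁ (ends G e)) ≡ t → side (proj₂ (ends G e)) ≡ t →
      onSide (proj₁ (ends G e)) (value₁ e) + onSide (proj₂ (ends G e)) (value₂ e) ≡ 0ℤ
    ends-cancel false x∉S y∉S rewrite x∉S | y∉S = refl
    ends-cancel true  x∈S y∈S rewrite x∈S | y∈S = begin
      value₁ e + value₂ e
        ≡⟨ cong (value₁ e +_) (joins-transmit {e} (inj₁ refl) (proj₁ flow e)) ⟩
      value₁ e + transmit (sign G e) (value₁ e)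
        ≡⟨ cong (λ σ → value₁ e + transmit σ (value₁ e)) (positive e x∈S y∈S) ⟩
      value₁ e + - value₁ e
        ≡⟨ ℤP.+-inverseʳ (value₁ e) ⟩
      0ℤ
        ∎

  -- exchanging the sums: Σ_e sideTotal e is the sum of the net flows over S
  sideTotal-sum : sum sideTotal ≡ 0ℤ
  sideTotal-sum = trans (∑-comm (λ e w → onSide w (contribution w e))) (sum-zero vertex-total)
    where
    vertex-total : ∀ w → sum (λ e → onSide w (contribution w e)) ≡ 0ℤ
    vertex-total w with side w
    ... | true  = conserved⇒net≡0 w (proj₂ flow w)
    ... | false = sum-replicate-zero (m G)

  cut-balance : ∀ {e₁ e₂} → e₁ ≢ e₂ → (∀ e → Crossing G side e → e ≡ e₁ ⊎ e ≡ e₂) →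
    ∀ {a₁ c₁ a₂ c₂} (J₁ : Joins G e₁ a₁ c₁) → side a₁ ≡ true → side c₁ ≡ false →
    (J₂ : Joins G e₂ a₂ c₂) → side a₂ ≡ true → side c₂ ≡ false →
    valueAt J₁ + valueAt J₂ ≡ 0ℤ
  cut-balance {e₁} {e₂} e₁≢e₂ cut J₁ a₁∈S c₁∉S J₂ a₂∈S c₂∉S = begin
    valueAt J₁ + valueAt J₂
      ≡⟨ cong₂ _+_ (cut-edge J₁ a₁∈S c₁∉S) (cut-edge J₂ a₂∈S c₂∉S) ⟨
    sideTotal e₁ + sideTotal e₂
      ≡⟨ cong (_+ sideTotal e₂) (ℤP.+-identityˡ (sideTotal e₁)) ⟨
    0ℤ + sideTotal e₁ + sideTotal e₂
      ≡⟨ cong (λ t → t + sideTotal e₁ + sideTotal e₂) (sum-replicate-zero (m G)) ⟨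
    sum {m G} (λ _ → 0ℤ) + sideTotal e₁ + sideTotal e₂
      ≡⟨ sum-along-cut sideTotal (λ _ → 0ℤ) sideTotal-off-cut (λ _ _ → refl) ⟨
    sum sideTotal
      ≡⟨ sideTotal-sum ⟩
    0ℤ
      ∎
    where
    open TwoEdgeCut G side e₁ e₂ e₁≢e₂ cut (joins-crossing G side J₁ a₁∈S c₁∉S)
                                           (joins-crossing G side J₂ a₂∈S c₂∉S)
    cut-edge : ∀ {e a c} (J : Joins G e a c) → side a ≡ true → side c ≡ false →
               sideTotal e ≡ valueAt J
    cut-edge J a∈S c∉S rewrite sideTotal-joins J | a∈S | c∉S = ℤP.+-identityʳ _

module FilteredTable {A B : Set} (h : A → Maybe B) where

  origin : ∀ {k} (f : Fin k → A) → Fin (length (mapMaybe h (tabulate f))) → Fin k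
  origin {suc k} f j with h (f zero)
  origin {suc k} f zero    | just _  = zero
  origin {suc k} f (suc j) | just _  = suc (origin (f ∘ suc) j)
  origin {suc k} f j       | nothing = suc (origin (f ∘ suc) j)

  origin-spec : ∀ {k} (f : Fin k → A) j →
    h (f (origin f j)) ≡ just (lookup (mapMaybe h (tabulate f)) j)
  origin-spec {suc k} f j with h (f zero) in accepted
  origin-spec {suc k} f zero    | just _  = accepted
  origin-spec {suc k} f (suc j) | just _  = origin-spec (f ∘ suc) j
  origin-spec {suc k} f j       | nothing = origin-spec (f ∘ suc) j

  sum-filtered : ∀ {k} (f : Fin k → A) (g : B → Fin k → ℤ) →
    sum (λ j → g (lookup (mapMaybe h (tabulate f)) j) (origin f j))
      ≡ sum (λ i → maybe′ (λ x → g x i) 0ℤ (h (f i)))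
  sum-filtered {zero}  f g = refl
  sum-filtered {suc k} f g with h (f zero)
  ... | just x  = cong (g x zero +_) (sum-filtered (f ∘ suc) (λ x i → g x (suc i)))
  ... | nothing = trans (sum-filtered (f ∘ suc) (λ x i → g x (suc i))) (sym (ℤP.+-identityˡ _))

module InducedPart {n : ℕ} (side : Fin n → Bool) (b : Bool) where

  part-≡ : (p q : Part side b) → proj₁ p ≡ proj₁ q → p ≡ q
  part-≡ (x , x∈) (.x , x∈′) refl = cong (x ,_) (Decidable⇒UIP.≡-irrelevant Bool._≟_ x∈ x∈′)

  δ-part : ∀ (q p : Part side b) z → δ (Part-≟ side b) q p z ≡ δ _≟_ (proj₁ q) (proj₁ p) z
  δ-part q p z = cong (λ t → if t then z else 0ℤ) same-decision
    where
    same-decision : ⌊ Part-≟ side b q p ⌋ ≡ ⌊ proj₁ q ≟ proj₁ p ⌋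
    same-decision = trans (isYes≗does (Part-≟ side b q p))
      (trans (does-⇔ (mk⇔ (cong proj₁) (part-≡ q p)) (Part-≟ side b q p) (proj₁ q ≟ proj₁ p))
             (sym (isYes≗does (proj₁ q ≟ proj₁ p))))

  liftV-inside : ∀ {x} (x∈ : side x ≡ b) → liftV side b x ≡ just (x , x∈)
  liftV-inside {x} x∈ with side x Bool.≟ b
  ... | yes x∈′ = cong just (part-≡ _ _ refl)
  ... | no x∉   = ⊥-elim (x∉ x∈)

  liftV-outside : ∀ {x} → side x ≢ b → liftV side b x ≡ nothing
  liftV-outside {x} x∉ with side x Bool.≟ b
  ... | yes x∈ = ⊥-elim (x∉ x∈)
  ... | no _   = refl

  liftE-inside : ∀ {x y t} (x∈ : side x ≡ b) (y∈ : side y ≡ b) →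
    liftE side b (x , y , t) ≡ just ((x , x∈) , (y , y∈) , t)
  liftE-inside x∈ y∈ rewrite liftV-inside x∈ | liftV-inside y∈ = refl

  crossing-leaves : ∀ {x y} → side x ≢ side y → side x ≢ b ⊎ side y ≢ b
  crossing-leaves {x} crosses with side x Bool.≟ b
  ... | yes x∈ = inj₂ (λ y∈ → crosses (trans x∈ (sym y∈)))
  ... | no x∉  = inj₁ x∉

  liftE-outside : ∀ {x y t} → side x ≢ b ⊎ side y ≢ b → liftE side b (x , y , t) ≡ nothing
  liftE-outside (inj₁ x∉) rewrite liftV-outside x∉ = refl
  liftE-outside {x} (inj₂ y∉) rewrite liftV-outside y∉ with liftV side b x
  ... | just _  = refl
  ... | nothing = refl

  liftE-sign : ∀ {x y t q} → liftE side b (x , y , t) ≡ just q → proj₂ (proj₂ q) ≡ t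
  liftE-sign {x} {y} lifted with liftV side b x | liftV side b y
  liftE-sign refl | just _  | just _ = refl
  liftE-sign ()   | just _  | nothing
  liftE-sign ()   | nothing | _

module Restriction {n : ℕ} (G : SignedGraph (Fin n)) (side : Fin n → Bool) (b : Bool)
  {k : ℕ} {D : Fin (m G) → Bool × Bool} {φ : Fin (m G) → ℤ}
  (nz : IsNowhereZeroFlow _≟_ G D φ k)
  {e₁ e₂ : Fin (m G)} (e₁≢e₂ : e₁ ≢ e₂) (cut : ∀ e → Crossing G side e → e ≡ e₁ ⊎ e ≡ e₂)
  {a₁ c₁ a₂ c₂ : Fin n}
  (J₁ : Joins G e₁ a₁ c₁) (a₁∈ : side a₁ ≡ b) (c₁∉ : side c₁ ≡ not b)
  (J₂ : Joins G e₂ a₂ c₂) (a₂∈ : side a₂ ≡ b) (c₂∉ : side c₂ ≡ not b)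
  (s : Sign)
  (transmits : transmit s (Net.valueAt _≟_ G D φ J₁) ≡ Net.valueAt _≟_ G D φ J₂) where

  open Net _≟_ G D φ
  open InducedPart side b
  open FilteredTable (liftE side b)
  open TwoEdgeCut G side e₁ e₂ e₁≢e₂ cut (joins-crossing G side J₁ a₁∈ c₁∉)
                                         (joins-crossing G side J₂ a₂∈ c₂∉)

  edgeData : Fin (m G) → Fin n × Fin n × Sign
  edgeData e = proj₁ (ends G e) , proj₂ (ends G e) , sign G e

  G′ : SignedGraph (Part side b)
  G′ = inducedPlus G side b (a₁ , a₁∈) (a₂ , a₂∈) s

  old : Fin (length (inducedEdges G side b)) → Fin (m G)
  old = origin edgeData

  D′ : Fin (m G′) → Bool × Bool
  D′ zero    = dirAt J₁ , farDir s (dirAt J₁)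
  D′ (suc j) = D (old j)

  φ′ : Fin (m G′) → ℤ
  φ′ zero    = φ e₁
  φ′ (suc j) = φ (old j)

  module N′ = Net (Part-≟ side b) G′ D′ φ′

  orientation : IsOrientation G′ D′
  orientation zero    = farDir-valid s (dirAt J₁)
  orientation (suc j) = subst (λ σ → ValidDir σ (D (old j)))
    (sym (liftE-sign (origin-spec edgeData j))) (proj₁ (proj₁ nz) (old j))

  bounded : ∀ e → 0 < ∣ φ′ e ∣ × ∣ φ′ e ∣ < k
  bounded zero    = proj₂ nz e₁
  bounded (suc j) = proj₂ nz (old j)

  module AtVertex (p : Part side b) where

    p₀ : Fin n
    p₀ = proj₁ p

    cut-edge-at : ∀ {e a c} (J : Joins G e a c) → side c ≡ not b →
      contribution p₀ e ≡ δ _≟_ a p₀ (valueAt J)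
    cut-edge-at {e} {a} {c} J c∉ = begin
      contribution p₀ e
        ≡⟨ contribution-joins J p₀ ⟩
      δ _≟_ a p₀ (valueAt J) + δ _≟_ c p₀ (valueAt (reverse {G = G} J))
        ≡⟨ cong (δ _≟_ a p₀ (valueAt J) +_) (δ-off _≟_ _ c≢p₀) ⟩
      δ _≟_ a p₀ (valueAt J) + 0ℤ
        ≡⟨ ℤP.+-identityʳ _ ⟩
      δ _≟_ a p₀ (valueAt J)
        ∎
      where
      c≢p₀ : c ≢ p₀
      c≢p₀ c≡p₀ = not-¬ refl (trans (sym (proj₂ p)) (trans (cong side (sym c≡p₀)) c∉))

    new-edge : N′.contribution p zero ≡ contribution p₀ e₁ + contribution p₀ e₂
    new-edge = begin
      N′.contribution p zero
        ≡⟨ cong₂ _+_ (δ-part (a₁ , a₁∈) p _) (δ-part (a₂ , a₂∈) p _) ⟩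
      δ _≟_ a₁ p₀ (valueAt J₁) + δ _≟_ a₂ p₀ (signed (farDir s (dirAt J₁)) (φ e₁))
        ≡⟨ cong (λ z → δ _≟_ a₁ p₀ (valueAt J₁) + δ _≟_ a₂ p₀ z) far-end ⟩
      δ _≟_ a₁ p₀ (valueAt J₁) + δ _≟_ a₂ p₀ (valueAt J₂)
        ≡⟨ cong₂ _+_ (cut-edge-at J₁ c₁∉) (cut-edge-at J₂ c₂∉) ⟨
      contribution p₀ e₁ + contribution p₀ e₂
        ∎
      where
      far-end : signed (farDir s (dirAt J₁)) (φ e₁) ≡ valueAt J₂
      far-end = trans (valid⇒transmit s _ _ (φ e₁) (farDir-valid s (dirAt J₁))) transmits

    inheritedAt : Part side b × Part side b × Sign → Fin (m G) → ℤ
    inheritedAt (x , y , _) e =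
      δ (Part-≟ side b) x p (value₁ e) + δ (Part-≟ side b) y p (value₂ e)

    inherited : Fin (m G) → ℤ
    inherited e = maybe′ (λ q → inheritedAt q e) 0ℤ (liftE side b (edgeData e))

    inherited-cut : ∀ e → Crossing G side e → inherited e ≡ 0ℤ
    inherited-cut e crosses rewrite liftE-outside {t = sign G e} (crossing-leaves crosses) = refl

    inherited-off-cut : ∀ e → SameSide G side e → contribution p₀ e ≡ inherited e
    inherited-off-cut e same = by-side (side (proj₁ (ends G e)) Bool.≟ b)
      where
      on-side : ∀ {w} → w ≡ p₀ → side w ≡ b
      on-side refl = proj₂ p
      by-side : Dec (side (proj₁ (ends G e)) ≡ b) → contribution p₀ e ≡ inherited e
      by-side (yes x∈) rewrite liftE-inside {t = sign G e} x∈ (trans (sym same) x∈) =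
        sym (cong₂ _+_ (δ-part (_ , x∈) p (value₁ e))
                       (δ-part (_ , trans (sym same) x∈) p (value₂ e)))
      by-side (no x∉) rewrite liftE-outside {y = proj₂ (ends G e)} {t = sign G e} (inj₁ x∉) =
        cong₂ _+_ (δ-off _≟_ _ (x∉ ∘ on-side)) (δ-off _≟_ _ (x∉ ∘ trans same ∘ on-side))

    -- the new edge plus the inherited edges carry the net flow of G at p₀
    conservation : N′.net p ≡ 0ℤ
    conservation = begin
      N′.net p
        ≡⟨ cong₂ _+_ new-edge (sum-filtered edgeData inheritedAt) ⟩
      (contribution p₀ e₁ + contribution p₀ e₂) + sum inherited
        ≡⟨ ℤP.+-comm _ (sum inherited) ⟩
      sum inherited + (contribution p₀ e₁ + contribution p₀ e₂)
        ≡⟨ ℤP.+-assoc (sum inherited) _ _ ⟨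
      sum inherited + contribution p₀ e₁ + contribution p₀ e₂
        ≡⟨ sum-along-cut (contribution p₀) inherited inherited-off-cut inherited-cut ⟨
      net p₀
        ≡⟨ conserved⇒net≡0 p₀ (proj₂ (proj₁ nz) p₀) ⟩
      0ℤ
        ∎

  restriction : FlowAdmissible (Part-≟ side b) G′
  restriction = k , D′ , φ′ , (orientation , conserved) , bounded
    where
    conserved : ∀ p → inflow (Part-≟ side b) G′ D′ φ′ p ≡ outflow (Part-≟ side b) G′ D′ φ′ p
    conserved p = N′.net≡0⇒conserved p (AtVertex.conservation p)

mainTheorem10 : ∀ {n : ℕ} (G : SignedGraph (Fin n)) (side : Fin n → Bool) →
    FlowAdmissible _≟_ G →
    (∃ λ w → side w ≡ false) → (∃ λ w → side w ≡ true) →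
    (u x v y : Fin n) (hu : side u ≡ false) (hx : side x ≡ false) →
    (hv : side v ≡ true) (hy : side y ≡ true) →
    (e₁ e₂ : Fin (m G)) → e₁ ≢ e₂ → Joins G e₁ u v → Joins G e₂ x y →
    (∀ e → side (proj₁ (ends G e)) ≢ side (proj₂ (ends G e)) → e ≡ e₁ ⊎ e ≡ e₂) →
    sign G e₁ ≡ pos →
    (∀ e → side (proj₁ (ends G e)) ≡ true → side (proj₂ (ends G e)) ≡ true → sign G e ≡ pos) →
    FlowAdmissible (Part-≟ side false) (inducedPlus G side false (u , hu) (x , hx) (sign G e₂))
    × FlowAdmissible (Part-≟ side true) (inducedPlus G side true (v , hv) (y , hy) pos)
mainTheorem10 G side (k , D , φ , nz) _ _ u x v y hu hx hv hy e₁ e₂ e₁≢e₂ J₁ J₂ cut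
              e₁-positive W₂-positive =
    Restriction.restriction G side false nz e₁≢e₂ cut J₁ hu hv J₂ hx hy (sign G e₂) W₁-transmits
  , Restriction.restriction G side true nz e₁≢e₂ cut J₁′ hv hu J₂′ hy hx pos W₂-transmits
  where
  open Net _≟_ G D φ
  J₁′ = reverse {G = G} J₁
  J₂′ = reverse {G = G} J₂

  W₂-transmits : transmit pos (valueAt J₁′) ≡ valueAt J₂′
  W₂-transmits = sym (inverseʳ-unique _ _
    (Balance.cut-balance G D φ (proj₁ nz) side W₂-positive e₁≢e₂ cut J₁′ hv hu J₂′ hy hx))

  v-from-u : valueAt J₁′ ≡ - valueAt J₁
  v-from-u = trans (joins-transmit J₁ (proj₁ (proj₁ nz) e₁))
                   (cong (λ σ → transmit σ (valueAt J₁)) e₁-positive)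

  u-to-y : valueAt J₁ ≡ valueAt J₂′
  u-to-y = begin
    valueAt J₁      ≡⟨ ℤP.neg-involutive (valueAt J₁) ⟨
    - - valueAt J₁  ≡⟨ cong -_ v-from-u ⟨
    - valueAt J₁′   ≡⟨ W₂-transmits ⟩
    valueAt J₂′     ∎

  W₁-transmits : transmit (sign G e₂) (valueAt J₁) ≡ valueAt J₂
  W₁-transmits = begin
    transmit σ₂ (valueAt J₁)                ≡⟨ cong (transmit σ₂) u-to-y ⟩
    transmit σ₂ (valueAt J₂′)
                                            ≡⟨ cong (transmit σ₂) (joins-transmit J₂ (proj₁ (proj₁ nz) e₂)) ⟩
    transmit σ₂ (transmit σ₂ (valueAt J₂))  ≡⟨ transmit-involutive σ₂ (valueAt J₂) ⟩
    valueAt J₂                              ∎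
    where
    σ₂ : Sign
    σ₂ = sign G e₂
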